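{- There exists a divisible design Cayley digraph with parameters $(8,3,0,1,4,2)$.
   Context: A digraph $D=(V,E)$ has a finite nonempty vertex set $V$ and arc set $E\subseteq\{(x,y):x,y\in V,\ x\neq y\}$; $x$ dominates $y$ if $(x,y)\in E$. $D$ is asymmetric if $(x,y)\in E$ implies $(y,x)\notin E$, and regular of degree $k$ if every vertex dominates exactly $k$ vertices and is dominated by exactly $k$ vertices. A divisible design digraph (DDD) with parameters $(v,k,\lambda_1,\lambda_2,m,n)$ is a regular asymmetric digraph of degree $k$ on $v$ vertices whose vertex set can be partitioned into $m$ classes of size $n$ such that for any two distinct vertices $x,y$ in the same class, the number of vertices dominating both and the number of vertices dominated by both are each $\lambda_1$, and for distinct vertices in different classes these numbers are each $\lambda_2$. For a finite group $G$ with identity $e$ and $S\subseteq G\setminus\{e\}$, the Cayley digraph ${\rm Cay}(G,S)$ has vertex set $G$ and arcs $(g,gs)$, $g\in G$, $s\in S$. A divisible design Cayley digraph with given parameters is a Cayley digraph which is a DDD with those parameters. -}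

module Defs where

open import Data.Nat using (ℕ; _*_)
open import Data.Fin using (Fin; _≟_)
open import Data.Bool using (Bool; true; false; if_then_else_; _∧_)
open import Data.List using (allFin; map)
open import Data.Nat.ListAction using (sum)
open import Data.Product using (Σ; _×_)
open import Relation.Binary.PropositionalEquality using (_≡_; _≢_)
open import Relation.Nullary.Decidable using (⌊_⌋)
open import Algebra.Structures using (IsGroup)

record FinGroup (v : ℕ) : Set where
  field
    _∙_     : Fin v → Fin v → Fin v
    ε       : Fin v
    _⁻¹     : Fin v → Fin v
    isGroup : IsGroup _≡_ _∙_ ε _⁻¹

-- A digraph on vertex set Fin v, given by a Boolean adjacency relation:
-- E x y ≡ true means x dominates y, i.e. (x , y) is an arc.
Digraph : ℕ → Set
Digraph v = Fin v → Fin v → Bool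

count : {v : ℕ} → (Fin v → Bool) → ℕ
count {v} p = sum (map (λ z → if p z then 1 else 0) (allFin v))

Loopless : {v : ℕ} → Digraph v → Set
Loopless E = ∀ x → E x x ≡ false

Asymmetric : {v : ℕ} → Digraph v → Set
Asymmetric E = ∀ x y → E x y ≡ true → E y x ≡ false

Regular : {v : ℕ} → Digraph v → ℕ → Set
Regular E k = ∀ x → (count (λ y → E x y) ≡ k) × (count (λ y → E y x) ≡ k)

commonIn : {v : ℕ} → Digraph v → Fin v → Fin v → ℕ
commonIn E x y = count (λ z → E z x ∧ E z y)

commonOut : {v : ℕ} → Digraph v → Fin v → Fin v → ℕ
commonOut E x y = count (λ z → E x z ∧ E y z)

-- Divisible design digraph with parameters (v,k,λ₁,λ₂,m,n):
-- the partition into m classes of size n is given by a class map Fin v → Fin m.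
IsDDD : (v k λ₁ λ₂ m n : ℕ) → Digraph v → Set
IsDDD v k λ₁ λ₂ m n E =
  Loopless E × Asymmetric E × Regular E k ×
  Σ (Fin v → Fin m) λ cls →
    (∀ (c : Fin m) → count (λ x → ⌊ cls x ≟ c ⌋) ≡ n) ×
    (∀ x y → x ≢ y → cls x ≡ cls y →
        (commonIn E x y ≡ λ₁) × (commonOut E x y ≡ λ₁)) ×
    (∀ x y → cls x ≢ cls y →
        (commonIn E x y ≡ λ₂) × (commonOut E x y ≡ λ₂))

-- Cayley digraph Cay(G,S): arcs (g , g s) for s ∈ S, i.e. (g , h) is an arc iff g⁻¹ h ∈ S.
-- S ⊆ G is given as a Boolean predicate.
Cay : {v : ℕ} → FinGroup v → (Fin v → Bool) → Digraph v
Cay G S g h = S ((g ⁻¹) ∙ h)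
  where open FinGroup G

AvoidsIdentity : {v : ℕ} → FinGroup v → (Fin v → Bool) → Set
AvoidsIdentity G S = S (FinGroup.ε G) ≡ false

-- The quaternion group Q₈ = {±1, ±i, ±j, ±k} with S = {i, j, k}, partitioned
-- into the cosets {±g} of its centre {±1}.  For s ≠ t in S the six quotients
-- t s⁻¹ = −t s are exactly ±i, ±j, ±k, each once, and never ±1: so S is a
-- relative difference set for the centre.  Hence two vertices of the same
-- coset share no in- or out-neighbour, and two vertices in different cosets
-- share exactly one.
module Submission where

open import Defs
open import Data.Nat using (ℕ)
import Data.Nat as ℕ
open import Data.Fin using (Fin; #_; _≟_; _↑ˡ_; _↑ʳ_)
open import Data.Fin.Properties using (all?)
open import Data.Bool using (Bool; true; false; not; _xor_)
import Data.Bool as Bool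
open import Data.Product using (Σ; _×_; _,_)
open import Data.Vec using (_∷_; []; lookup)
open import Relation.Nullary using (Dec)
open import Relation.Nullary.Decidable using (⌊_⌋; from-yes; _×-dec_; _→-dec_; ¬?)
open import Relation.Binary.PropositionalEquality using (_≡_; _≢_; refl; isEquivalence; cong; cong₂)

module _ {v : ℕ} (E : Digraph v) where

  loopless? : Dec (Loopless E)
  loopless? = all? λ x → E x x Bool.≟ false

  asymmetric? : Dec (Asymmetric E)
  asymmetric? = all? λ x → all? λ y → (E x y Bool.≟ true) →-dec (E y x Bool.≟ false)

  regular? : (k : ℕ) → Dec (Regular E k)
  regular? k = all? λ x →
    (count (λ y → E x y) ℕ.≟ k) ×-dec (count (λ y → E y x) ℕ.≟ k)

  module _ {m : ℕ} (cls : Fin v → Fin m) where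

    classSizes? : (n : ℕ) → Dec (∀ c → count (λ x → ⌊ cls x ≟ c ⌋) ≡ n)
    classSizes? n = all? λ c → count (λ x → ⌊ cls x ≟ c ⌋) ℕ.≟ n

    withinClasses? : (λ₁ : ℕ) →
      Dec (∀ x y → x ≢ y → cls x ≡ cls y →
             (commonIn E x y ≡ λ₁) × (commonOut E x y ≡ λ₁))
    withinClasses? λ₁ = all? λ x → all? λ y →
      ¬? (x ≟ y) →-dec ((cls x ≟ cls y) →-dec
        ((commonIn E x y ℕ.≟ λ₁) ×-dec (commonOut E x y ℕ.≟ λ₁)))

    acrossClasses? : (λ₂ : ℕ) →
      Dec (∀ x y → cls x ≢ cls y →
             (commonIn E x y ≡ λ₂) × (commonOut E x y ≡ λ₂))
    acrossClasses? λ₂ = all? λ x → all? λ y →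
      ¬? (cls x ≟ cls y) →-dec
        ((commonIn E x y ℕ.≟ λ₂) ×-dec (commonOut E x y ℕ.≟ λ₂))

data Basis : Set where
  𝟏 𝐢 𝐣 𝐤 : Basis

-- ±u is represented as (is-negative, u).
Quaternion : Set
Quaternion = Bool × Basis

-- Hamilton's rules i² = j² = k² = ijk = −1.
basisProduct : Basis → Basis → Quaternion
basisProduct 𝟏 u = false , u
basisProduct u 𝟏 = false , u
basisProduct 𝐢 𝐢 = true , 𝟏
basisProduct 𝐢 𝐣 = false , 𝐤
basisProduct 𝐢 𝐤 = true , 𝐣
basisProduct 𝐣 𝐢 = true , 𝐤
basisProduct 𝐣 𝐣 = true , 𝟏
basisProduct 𝐣 𝐤 = false , 𝐢
basisProduct 𝐤 𝐢 = false , 𝐣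
basisProduct 𝐤 𝐣 = true , 𝐢
basisProduct 𝐤 𝐤 = true , 𝟏

_*_ : Quaternion → Quaternion → Quaternion
(s , u) * (t , w) with basisProduct u w
... | r , z = s xor t xor r , z

isImaginary : Basis → Bool
isImaginary 𝟏 = false
isImaginary _ = true

conjugate : Quaternion → Quaternion
conjugate (s , u) = s xor isImaginary u , u

basisIndex : Basis → Fin 4
basisIndex 𝟏 = # 0
basisIndex 𝐢 = # 1
basisIndex 𝐣 = # 2
basisIndex 𝐤 = # 3

decode : Fin 8 → Quaternion
decode = lookup
  ( (false , 𝟏) ∷ (false , 𝐢) ∷ (false , 𝐣) ∷ (false , 𝐤)
  ∷ (true , 𝟏) ∷ (true , 𝐢) ∷ (true , 𝐣) ∷ (true , 𝐤) ∷ [])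

encode : Quaternion → Fin 8
encode (false , u) = basisIndex u ↑ˡ 4
encode (true , u) = 4 ↑ʳ basisIndex u

_·_ : Fin 8 → Fin 8 → Fin 8
a · b = encode (decode a * decode b)

_⁻¹ : Fin 8 → Fin 8
a ⁻¹ = encode (conjugate (decode a))

one : Fin 8
one = encode (false , 𝟏)

Q₈ : FinGroup 8
Q₈ = record
  { _∙_ = _·_
  ; ε = one
  ; _⁻¹ = _⁻¹
  ; isGroup = record
    { isMonoid = record
      { isSemigroup = record
        { isMagma = record { isEquivalence = isEquivalence ; ∙-cong = cong₂ _·_ }
        ; assoc = from-yes (all? λ x → all? λ y → all? λ z → ((x · y) · z) ≟ (x · (y · z)))
        }
      ; identity = from-yes (all? λ x → (one · x) ≟ x)
                 , from-yes (all? λ x → (x · one) ≟ x)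
      }
    ; inverse = from-yes (all? λ x → ((x ⁻¹) · x) ≟ one)
              , from-yes (all? λ x → (x · (x ⁻¹)) ≟ one)
    ; ⁻¹-cong = cong _⁻¹
    }
  }

positiveImaginary : Fin 8 → Bool
positiveImaginary a with decode a
... | s , u = not s Bool.∧ isImaginary u

centreCoset : Fin 8 → Fin 4
centreCoset a with decode a
... | _ , u = basisIndex u

mainTheorem11 : Σ (FinGroup 8) λ G → Σ (Fin 8 → Bool) λ S →
                    AvoidsIdentity G S × IsDDD 8 3 0 1 4 2 (Cay G S)
mainTheorem11 = Q₈ , positiveImaginary , refl
  , from-yes (loopless? E)
  , from-yes (asymmetric? E)
  , from-yes (regular? E 3)
  , centreCoset
  , from-yes (classSizes? E centreCoset 2)
  , from-yes (withinClasses? E centreCoset 0)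
  , from-yes (acrossClasses? E centreCoset 1)
  where
    E : Digraph 8
    E = Cay Q₈ positiveImaginary
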